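{- Let $X$ and $Y$ be definable sets in a structure $\mathcal M$. Then $X$ and $Y$ are orthogonal if and only if for every positive integer $n$, every definable subset of $X^n\times Y$ is a finite union of $(X^n,Y)$-boxes.
   Context: "Definable" means definable in $\mathcal M$ with parameters. A $(Y_1,\ldots,Y_k)$-box is a definable set $U_1\times\cdots\times U_k$ with $U_i\subseteq Y_i$. Definable sets $X$ and $Y$ are orthogonal if for all $k,l\in\mathbb N$ every definable subset of $X^{k}\times Y^{l}$ is a finite union of $(X^{k},Y^{l})$-boxes. -}

module Defs where

open import Level using (0ℓ)
open import Data.Nat using (ℕ; zero; suc; _+_; _*_)
open import Data.Fin using (Fin)
open import Data.Vec using (Vec; []; _∷_; tabulate; _++_; take; drop)
open import Data.List using (List)
open import Data.List.Relation.Unary.All using (All)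
open import Data.List.Relation.Unary.Any using (Any)
open import Data.Product using (Σ; _×_; _,_)
open import Data.Sum using (_⊎_)
open import Data.Unit using (⊤)
open import Data.Empty using (⊥)
open import Relation.Binary.PropositionalEquality using (_≡_)
open import Function.Bundles using (_⇔_)

-- First-order languages and structures (classical Tarskian semantics
-- is recovered by assuming excluded middle in the theorem).

record Language : Set₁ where
  field
    Func : ℕ → Set
    Rel  : ℕ → Set

record Structure (L : Language) : Set₁ where
  open Language L
  field
    Carrier : Set
    funI    : ∀ {k} → Func k → Vec Carrier k → Carrier
    relI    : ∀ {k} → Rel k → Vec Carrier k → Set

module _ (L : Language) where
  open Language L

  data Term (n : ℕ) : Set where
    var : Fin n → Term n
    app : ∀ {k} → Func k → (Fin k → Term n) → Term n

  data Formula : ℕ → Set where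
    equal : ∀ {n} → Term n → Term n → Formula n
    rel   : ∀ {n k} → Rel k → (Fin k → Term n) → Formula n
    neg   : ∀ {n} → Formula n → Formula n
    and   : ∀ {n} → Formula n → Formula n → Formula n
    or    : ∀ {n} → Formula n → Formula n → Formula n
    ex    : ∀ {n} → Formula (suc n) → Formula n
    all   : ∀ {n} → Formula (suc n) → Formula n

module Semantics {L : Language} (𝓜 : Structure L) where
  open Language L
  open Structure 𝓜

  M : Set
  M = Carrier

  eval : ∀ {n} → Vec M n → Term L n → M
  eval ρ (var i)    = Data.Vec.lookup ρ i
  eval ρ (app f ts) = funI f (tabulate (λ i → eval ρ (ts i)))

  Sat : ∀ {n} → Formula L n → Vec M n → Set
  Sat (equal s t) ρ = eval ρ s ≡ eval ρ t
  Sat (rel R ts)  ρ = relI R (tabulate (λ i → eval ρ (ts i)))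
  Sat (neg φ)     ρ = Sat φ ρ → ⊥
  Sat (and φ ψ)   ρ = Sat φ ρ × Sat ψ ρ
  Sat (or φ ψ)    ρ = Sat φ ρ ⊎ Sat ψ ρ
  Sat (ex φ)      ρ = Σ M (λ a → Sat φ (a ∷ ρ))
  Sat (all φ)     ρ = (a : M) → Sat φ (a ∷ ρ)

  Subset : ℕ → Set₁
  Subset n = Vec M n → Set

  _⊆_ : ∀ {n} → Subset n → Subset n → Set
  A ⊆ B = ∀ v → A v → B v

  Definable : ∀ {n} → Subset n → Set
  Definable {n} D =
    Σ ℕ λ p → Σ (Formula L (n + p)) λ φ → Σ (Vec M p) λ c →
      ∀ x → D x ⇔ Sat φ (x ++ c)

  Pow : ∀ {a} → Subset a → (k : ℕ) → Subset (k * a)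
  Pow X zero    v = ⊤
  Pow {a} X (suc k) v = X (take a v) × Pow X k (drop a v)

  Prod : ∀ {p q} → Subset p → Subset q → Subset (p + q)
  Prod {p} U V v = U (take p v) × V (drop p v)

  IsBoxFor : ∀ {p q} → Subset p → Subset q → Subset p × Subset q → Set
  IsBoxFor P Q (U , V) = (Definable U × U ⊆ P) × (Definable V × V ⊆ Q)

  FinUnionOfBoxes : ∀ {p q} → Subset p → Subset q → Subset (p + q) → Set₁
  FinUnionOfBoxes {p} {q} P Q D =
    Σ (List (Subset p × Subset q)) λ bs →
      All (IsBoxFor P Q) bs ×
      (∀ v → D v ⇔ Any (λ { (U , V) → Prod U V v }) bs)

  Orthogonal : ∀ {a b} → Subset a → Subset b → Set₁
  Orthogonal {a} {b} X Y =
    (k l : ℕ) (D : Subset (k * a + l * b)) → Definable D →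
    D ⊆ Prod (Pow X k) (Pow Y l) →
    FinUnionOfBoxes (Pow X k) (Pow Y l) D

module Submission where

-- A definable D ⊆ P × Q is a finite union of definable boxes iff its fibres over P fall into finitely
-- many classes: the boxes are then (class of x) × (fibre of x).  So orthogonality says that every
-- definable D ⊆ Xᵏ × Yˡ has finitely many fibre types over Xᵏ, and the hypothesis gives this for l = 1.
-- Induct on l.  For D ⊆ Xᵏ × Y × Yˡ let E(x, x′, z) say that x, x′ have the same fibre in the section
-- D_z ⊆ Xᵏ × Y.  E ⊆ X²ᵏ × Yˡ is definable, so by induction it is a finite union of boxes, and the
-- z ∈ Yˡ fall into finitely many E-types z₁ … z_m.  Each section D_{zᵢ} has finitely many fibre
-- types; points x, x′ lying in the same class for all of them have the same fibre at every zᵢ,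
-- hence, through E, at every z.  Excluded middle is used to split into classes and to express ⇔.

open import Defs
open import Level using (0ℓ)
open import Axiom.ExcludedMiddle using (ExcludedMiddle)
open import Data.Nat using (ℕ; zero; suc; _+_; _*_; _≤_; s≤s; z≤n)
open import Data.Fin as Fin using (Fin; _↑ˡ_; _↑ʳ_; splitAt)
open import Data.Vec using (Vec; []; _∷_; lookup; _++_; take; drop)
open import Data.Vec.Properties
  using (tabulate-cong; lookup-++ˡ; lookup-++ʳ; lookup-splitAt; take++drop≡id; ++-injectiveˡ; ++-injectiveʳ)
open import Data.List as List using (List; []; _∷_; concatMap) renaming (_++_ to _++ˡ_)
open import Data.List.Relation.Unary.All as All using (All; []; _∷_)
import Data.List.Relation.Unary.All.Properties as All
open import Data.List.Relation.Unary.Any as Any using (Any; here; there)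
import Data.List.Relation.Unary.Any.Properties as Any
open import Data.Product using (Σ; _×_; _,_; proj₁; proj₂)
open import Data.Product.Function.NonDependent.Propositional using (_×-⇔_)
open import Data.Sum using (_⊎_; inj₁; inj₂; [_,_]′)
open import Data.Sum.Function.Propositional using (_⊎-⇔_)
open import Data.Unit using (⊤; tt)
open import Data.Empty using (⊥-elim)
open import Function using (_∘_; case_of_)
open import Function.Bundles using (_⇔_; mk⇔; Equivalence)
open import Function.Construct.Identity using (⇔-id)
open import Function.Construct.Symmetry using (⇔-sym)
open import Function.Construct.Composition using () renaming (equivalence to ⇔-trans)
open import Function.Related.TypeIsomorphisms using (¬-cong-⇔)
open import Relation.Binary.PropositionalEquality
  using (_≡_; refl; sym; trans; cong; cong₂; _≗_; module ≡-Reasoning)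
open import Relation.Nullary using (¬_; yes; no)

open Equivalence using (to; from)

≡⇒⇔ : {A B : Set} → A ≡ B → A ⇔ B
≡⇒⇔ refl = ⇔-id _

∀-cong-⇔ : {A : Set} {P Q : A → Set} → (∀ a → P a ⇔ Q a) → (∀ a → P a) ⇔ (∀ a → Q a)
∀-cong-⇔ e = mk⇔ (λ p a → to (e a) (p a)) (λ q a → from (e a) (q a))

∃-cong-⇔ : {A : Set} {P Q : A → Set} → (∀ a → P a ⇔ Q a) → Σ A P ⇔ Σ A Q
∃-cong-⇔ e = mk⇔ (λ (a , p) → a , to (e a) p) (λ (a , q) → a , from (e a) q)

⇔-cong-⇔ : {A A′ B B′ : Set} → A ⇔ A′ → B ⇔ B′ → (A ⇔ B) ⇔ (A′ ⇔ B′)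
⇔-cong-⇔ eA eB = mk⇔ (λ e → ⇔-trans (⇔-sym eA) (⇔-trans e eB)) (λ e → ⇔-trans eA (⇔-trans e (⇔-sym eB)))

¬⊎⇔→ : ExcludedMiddle 0ℓ → {P Q : Set} → (¬ P ⊎ Q) ⇔ (P → Q)
¬⊎⇔→ em {P} = mk⇔ [ (λ ¬p p → ⊥-elim (¬p p)) , (λ q _ → q) ]′ λ f → case em {P} of λ where
  (yes p) → inj₂ (f p)
  (no ¬p) → inj₁ ¬p

ext : ∀ {n m} → (Fin n → Fin m) → Fin (suc n) → Fin (suc m)
ext ρ Fin.zero    = Fin.zero
ext ρ (Fin.suc i) = Fin.suc (ρ i)

reindex : ∀ m {p r} → (Fin p → Fin r) → Fin (m + p) → Fin (m + r)
reindex m {r = r} σ = [ _↑ˡ r , (m ↑ʳ_) ∘ σ ]′ ∘ splitAt m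

module _ {A : Set} where

  take-++ : ∀ {m n} (x : Vec A m) (y : Vec A n) → take m (x ++ y) ≡ x
  take-++ {m} x y = ++-injectiveˡ (take m (x ++ y)) x (take++drop≡id m (x ++ y))

  drop-++ : ∀ {m n} (x : Vec A m) (y : Vec A n) → drop m (x ++ y) ≡ y
  drop-++ {m} x y = ++-injectiveʳ (take m (x ++ y)) x (take++drop≡id m (x ++ y))

  lookup-take : ∀ m {n} (v : Vec A (m + n)) → lookup (take m v) ≗ lookup v ∘ (_↑ˡ n)
  lookup-take m v i =
    trans (sym (lookup-++ˡ (take m v) (drop m v) i)) (cong (λ u → lookup u (i ↑ˡ _)) (take++drop≡id m v))

  lookup-drop : ∀ m {n} (v : Vec A (m + n)) → lookup (drop m v) ≗ lookup v ∘ (m ↑ʳ_)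
  lookup-drop m v i =
    trans (sym (lookup-++ʳ (take m v) (drop m v) i)) (cong (λ u → lookup u (m ↑ʳ i)) (take++drop≡id m v))

  lookup-ext : ∀ {n m} {ρ : Fin n → Fin m} {w : Vec A n} {v : Vec A m} →
    lookup w ≗ lookup v ∘ ρ → ∀ a → lookup (a ∷ w) ≗ lookup (a ∷ v) ∘ ext ρ
  lookup-ext h a Fin.zero    = refl
  lookup-ext h a (Fin.suc i) = h i

  lookup-++-via : ∀ {n p N} (u : Vec A n) (d : Vec A p) (w : Vec A N) {α : Fin n → Fin N} {β : Fin p → Fin N} →
    lookup u ≗ lookup w ∘ α → lookup d ≗ lookup w ∘ β → lookup (u ++ d) ≗ lookup w ∘ [ α , β ]′ ∘ splitAt n
  lookup-++-via {n} u d w hu hd i rewrite lookup-splitAt n u d i with splitAt n i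
  ... | inj₁ j = hu j
  ... | inj₂ j = hd j

  lookup-reindex : ∀ {m p r} (v : Vec A m) {c : Vec A p} {e : Vec A r} (σ : Fin p → Fin r) →
    lookup c ≗ lookup e ∘ σ → lookup (v ++ c) ≗ lookup (v ++ e) ∘ reindex m σ
  lookup-reindex v {e = e} σ hσ =
    lookup-++-via v _ (v ++ e) (λ i → sym (lookup-++ˡ v e i)) (λ j → trans (hσ j) (sym (lookup-++ʳ v e (σ j))))

  appendPow : ∀ a k {k′} → Vec A (k * a) → Vec A (k′ * a) → Vec A ((k + k′) * a)
  appendPow a zero         u w = w
  appendPow a (suc k) {k′} u w = take a u ++ appendPow a k {k′} (drop a u) w

  splitPow : ∀ a k {k′} → Vec A ((k + k′) * a) → Vec A (k * a) × Vec A (k′ * a)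
  splitPow a zero         v = [] , v
  splitPow a (suc k) {k′} v = take a v ++ proj₁ (splitPow a k {k′} (drop a v)) , proj₂ (splitPow a k {k′} (drop a v))

  splitPow-appendPow : ∀ a k {k′} (u : Vec A (k * a)) (w : Vec A (k′ * a)) →
    splitPow a k {k′} (appendPow a k {k′} u w) ≡ (u , w)
  splitPow-appendPow a zero         [] w = refl
  splitPow-appendPow a (suc k) {k′} u  w = begin
    splitPow a (suc k) {k′} (take a u ++ appendPow a k {k′} (drop a u) w)
      ≡⟨ cong₂ (λ t s → t ++ proj₁ s , proj₂ s) (take-++ (take a u) _)
               (trans (cong (splitPow a k {k′}) (drop-++ (take a u) _)) (splitPow-appendPow a k {k′} (drop a u) w)) ⟩
    (take a u ++ drop a u , w)
      ≡⟨ cong (_, w) (take++drop≡id a u) ⟩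
    (u , w) ∎
    where open ≡-Reasoning

-- Fibre types of binary relations

module _ {A B : Set} where

  SameFibre : (A → B → Set) → A → A → Set
  SameFibre R x x′ = ∀ y → R x y ⇔ R x′ y

  FiniteFibreTypes : (A → Set) → (A → B → Set) → Set
  FiniteFibreTypes P R = Σ (List A) λ xs → ∀ x → P x → Any (SameFibre R x) xs

  Box : Set₁
  Box = (A → Set) × (B → Set)

  InBox : Box → A → B → Set
  InBox (U , V) x y = U x × V y

  BoxCover : (A → B → Set) → List Box → Set₁
  BoxCover R bs = ∀ x y → R x y ⇔ Any (λ b → InBox b x y) bs

finiteFibreTypes-map : {A B B′ : Set} {P : A → Set} {R : A → B → Set} {R′ : A → B′ → Set} (f : B′ → B) →
  (∀ x y → R′ x y ⇔ R x (f y)) → FiniteFibreTypes P R → FiniteFibreTypes P R′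
finiteFibreTypes-map f e (xs , types) =
  xs , λ x p → Any.map (λ same y → ⇔-trans (e x y) (⇔-trans (same (f y)) (⇔-sym (e _ y)))) (types x p)

finiteFibreTypes-Vec₀ˡ : ∀ {B C : Set} (P : Vec C 0 → Set) (R : Vec C 0 → B → Set) → FiniteFibreTypes P R
finiteFibreTypes-Vec₀ˡ P R = [] ∷ [] , λ { [] _ → here λ _ → ⇔-id _ }

Any-ap : ∀ {ℓ} {I : Set ℓ} {P Q : I → Set} {xs : List I} → All (λ i → P i → Q i) xs → Any P xs → Any Q xs
Any-ap (f ∷ _)  (here p)  = here (f p)
Any-ap (_ ∷ fs) (there p) = there (Any-ap fs p)

Agree : ∀ {ℓ} {I : Set ℓ} {A : Set} → (I → A → Set) → List I → A → A → Set ℓ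
Agree f us x x′ = All (λ u → f u x ⇔ f u x′) us

module _ {A B C : Set} (P : A → Set) (Q : C → Set) (S : A → B → C → Set) where

  Section : C → A → B → Set
  Section z x y = S x y z

  SameFibreAt : C → A × A → Set
  SameFibreAt z xx = P (proj₁ xx) × P (proj₂ xx) × Q z × SameFibre (Section z) (proj₁ xx) (proj₂ xx)

module _ (em : ExcludedMiddle 0ℓ) where

  -- One point of P in each non-empty cell of the partition of P cut out by the predicates f u.
  representatives : ∀ {ℓ} {I : Set ℓ} {A : Set} (f : I → A → Set) (us : List I) (P : A → Set) →
    Σ (List A) λ xs → ∀ x → P x → Any (λ x′ → P x′ × Agree f us x x′) xs
  representatives f [] P with em {Σ _ P}
  ... | yes (x₀ , p₀) = x₀ ∷ [] , λ _ _ → here (p₀ , [])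
  ... | no ∄x         = [] , λ x p → ⊥-elim (∄x (x , p))
  representatives f (u ∷ us) P = proj₁ with-u ++ˡ proj₁ without-u , classify
    where
    with-u    = representatives f us (λ x → P x × f u x)
    without-u = representatives f us (λ x → P x × ¬ f u x)
    classify : ∀ x → P x → Any (λ x′ → P x′ × Agree f (u ∷ us) x x′) (proj₁ with-u ++ˡ proj₁ without-u)
    classify x p with em {f u x}
    ... | yes fx = Any.++⁺ˡ (Any.map (λ ((p′ , fx′) , ag) → p′ , mk⇔ (λ _ → fx′) (λ _ → fx) ∷ ag)
                                     (proj₂ with-u x (p , fx)))
    ... | no ¬fx = Any.++⁺ʳ (proj₁ with-u)
                     (Any.map (λ ((p′ , ¬fx′) , ag) → p′ , mk⇔ (⊥-elim ∘ ¬fx) (⊥-elim ∘ ¬fx′) ∷ ag)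
                              (proj₂ without-u x (p , ¬fx)))

  finiteFibreTypes-Vec₀ʳ : ∀ {A C : Set} (P : A → Set) (R : A → Vec C 0 → Set) → FiniteFibreTypes P R
  finiteFibreTypes-Vec₀ʳ P R = proj₁ reps , λ x p → Any.map (λ { (_ , e ∷ []) [] → e }) (proj₂ reps x p)
    where reps = representatives (λ (_ : ⊤) x → R x []) (tt ∷ []) P

  module _ {A B : Set} {R : A → B → Set} {bs : List (Box {A} {B})} (cover : BoxCover R bs) where

    boxCover⇒finiteFibreTypesˡ : (P : A → Set) → FiniteFibreTypes P R
    boxCover⇒finiteFibreTypesˡ P = proj₁ reps , λ x p → Any.map (λ (_ , ag) → sameFibre ag) (proj₂ reps x p)
      where
      reps = representatives proj₁ bs P
      move : ∀ {x x′ y} → Agree proj₁ bs x x′ → R x y → R x′ y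
      move {y = y} ag r = from (cover _ y) (Any-ap (All.map (λ e (u , v) → to e u , v) ag) (to (cover _ y) r))
      sameFibre : ∀ {x x′} → Agree proj₁ bs x x′ → SameFibre R x x′
      sameFibre ag y = mk⇔ (move ag) (move (All.map ⇔-sym ag))

    boxCover⇒finiteFibreTypesʳ : (Q : B → Set) → FiniteFibreTypes Q (λ y x → R x y)
    boxCover⇒finiteFibreTypesʳ Q = proj₁ reps , λ y q → Any.map (λ (_ , ag) → sameFibre ag) (proj₂ reps y q)
      where
      reps = representatives proj₂ bs Q
      move : ∀ {y y′ x} → Agree proj₂ bs y y′ → R x y → R x y′
      move {x = x} ag r = from (cover x _) (Any-ap (All.map (λ e (u , v) → u , to e v) ag) (to (cover x _) r))
      sameFibre : ∀ {y y′} → Agree proj₂ bs y y′ → SameFibre (λ y x → R x y) y y′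
      sameFibre ag x = mk⇔ (move ag) (move (All.map ⇔-sym ag))

  finiteFibreTypes-glue : ∀ {A B C : Set} (P : A → Set) (Q : C → Set) (S : A → B → C → Set) →
    (∀ x y z → S x y z → Q z) → (∀ z → FiniteFibreTypes P (Section P Q S z)) →
    FiniteFibreTypes Q (SameFibreAt P Q S) → FiniteFibreTypes P (λ x yz → S x (proj₁ yz) (proj₂ yz))
  finiteFibreTypes-glue {A = A} {C = C} P Q S S⊆Q sections (zs , sameFibreAt-types) =
    proj₁ reps , λ x p → Any.map (λ (p′ , ag) (y , z) → sameFibre p p′ ag y z) (proj₂ reps x p)
    where
    pairs : List (C × A)
    pairs = concatMap (λ z′ → List.map (z′ ,_) (proj₁ (sections z′))) zs

    sameSection : C × A → A → Set
    sameSection (z′ , r) x = SameFibre (Section P Q S z′) x r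

    reps = representatives sameSection pairs P

    -- Take z′ of the same SameFibreAt-type as z (so Q z′, since x has the same fibre as itself at z) and
    -- the representative r of x in the section at z′; x′ agrees with x on having r's fibre at z′.
    sameFibreAt : ∀ {x x′} → P x → P x′ → Agree sameSection pairs x x′ → ∀ z → Q z → SameFibre (Section P Q S z) x x′
    sameFibreAt {x} {x′} p p′ ag z q = proj₂ (proj₂ (proj₂ (from (z≈z′ (x , x′)) (p , p′ , q′ , sameAtZ′))))
      where
      z∼z′ = sameFibreAt-types z q
      z′ = Any.lookup z∼z′
      agreeAtZ′ = All.lookupAny (All.map⁻ (All.concat⁻ ag)) z∼z′
      z≈z′ = proj₂ agreeAtZ′
      q′ : Q z′
      q′ = proj₁ (proj₂ (proj₂ (to (z≈z′ (x , x)) (p , p , q , λ _ → ⇔-id _))))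
      agreeAtR = All.lookupAny (All.map⁻ (proj₁ agreeAtZ′)) (proj₂ (sections z′) x p)
      sameAtZ′ : SameFibre (Section P Q S z′) x x′
      sameAtZ′ y = ⇔-trans (proj₂ agreeAtR y) (⇔-sym (to (proj₁ agreeAtR) (proj₂ agreeAtR) y))

    sameFibre : ∀ {x x′} → P x → P x′ → Agree sameSection pairs x x′ → ∀ y z → S x y z ⇔ S x′ y z
    sameFibre p p′ ag y z = mk⇔ (λ s → to (sameFibreAt p p′ ag z (S⊆Q _ y z s) y) s)
                                (λ s → from (sameFibreAt p p′ ag z (S⊆Q _ y z s) y) s)

-- Renaming and definability

module _ {L : Language} where
  open Language L

  renameTerm : ∀ {n m} → (Fin n → Fin m) → Term L n → Term L m
  renameTerm ρ (var i)    = var (ρ i)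
  renameTerm ρ (app f ts) = app f (renameTerm ρ ∘ ts)

  rename : ∀ {n m} → (Fin n → Fin m) → Formula L n → Formula L m
  rename ρ (equal s t) = equal (renameTerm ρ s) (renameTerm ρ t)
  rename ρ (rel R ts)  = rel R (renameTerm ρ ∘ ts)
  rename ρ (neg φ)     = neg (rename ρ φ)
  rename ρ (and φ ψ)   = and (rename ρ φ) (rename ρ ψ)
  rename ρ (or φ ψ)    = or (rename ρ φ) (rename ρ ψ)
  rename ρ (ex φ)      = ex (rename (ext ρ) φ)
  rename ρ (all φ)     = all (rename (ext ρ) φ)

  _⟺_ : ∀ {n} → Formula L n → Formula L n → Formula L n
  φ ⟺ ψ = and (or (neg φ) ψ) (or (neg ψ) φ)

module Definability {L : Language} (𝓜 : Structure L) where
  open Structure 𝓜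
  open Semantics 𝓜

  eval-rename : ∀ {n m} (ρ : Fin n → Fin m) {w : Vec M n} {v : Vec M m} →
    lookup w ≗ lookup v ∘ ρ → ∀ t → eval v (renameTerm ρ t) ≡ eval w t
  eval-rename ρ h (var i)    = sym (h i)
  eval-rename ρ h (app f ts) = cong (funI f) (tabulate-cong (eval-rename ρ h ∘ ts))

  sat-rename : ∀ {n m} (ρ : Fin n → Fin m) {w : Vec M n} {v : Vec M m} →
    lookup w ≗ lookup v ∘ ρ → ∀ φ → Sat (rename ρ φ) v ⇔ Sat φ w
  sat-rename ρ h (equal s t) = ≡⇒⇔ (cong₂ _≡_ (eval-rename ρ h s) (eval-rename ρ h t))
  sat-rename ρ h (rel R ts)  = ≡⇒⇔ (cong (relI R) (tabulate-cong (eval-rename ρ h ∘ ts)))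
  sat-rename ρ h (neg φ)     = ¬-cong-⇔ (sat-rename ρ h φ)
  sat-rename ρ h (and φ ψ)   = sat-rename ρ h φ ×-⇔ sat-rename ρ h ψ
  sat-rename ρ h (or φ ψ)    = sat-rename ρ h φ ⊎-⇔ sat-rename ρ h ψ
  sat-rename ρ h (ex φ)      = ∃-cong-⇔ λ a → sat-rename (ext ρ) (lookup-ext h a) φ
  sat-rename ρ h (all φ)     = ∀-cong-⇔ λ a → sat-rename (ext ρ) (lookup-ext h a) φ

  definable-cong : ∀ {n} {A B : Subset n} → (∀ v → A v ⇔ B v) → Definable A → Definable B
  definable-cong e (p , φ , c , hA) = p , φ , c , λ x → ⇔-trans (⇔-sym (e x)) (hA x)

  definable-⊤ : ∀ {n} → Definable {n} (λ _ → ⊤)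
  definable-⊤ = 0 , all (equal (var Fin.zero) (var Fin.zero)) , [] , λ _ → mk⇔ (λ _ _ → refl) (λ _ → tt)

  definable-connective :
    (_∙_ : ∀ {k} → Formula L k → Formula L k → Formula L k) (_⊙_ : Set → Set → Set) →
    (∀ {A A′ B B′} → A ⇔ A′ → B ⇔ B′ → (A ⊙ B) ⇔ (A′ ⊙ B′)) →
    (∀ {k} φ ψ (v : Vec M k) → Sat (φ ∙ ψ) v ⇔ (Sat φ v ⊙ Sat ψ v)) →
    ∀ {n} {A B : Subset n} → Definable A → Definable B → Definable (λ v → A v ⊙ B v)
  definable-connective _∙_ _⊙_ ⊙-cong sat-∙ {n} (p , φ , c , hA) (q , ψ , d , hB) =
    p + q , φ′ ∙ ψ′ , c ++ d , λ x →
      ⇔-trans (⊙-cong (⇔-trans (hA x) (⇔-sym (sat-rename _ (lookup-reindex x _ lookup-c) φ)))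
                      (⇔-trans (hB x) (⇔-sym (sat-rename _ (lookup-reindex x _ lookup-d) ψ))))
              (⇔-sym (sat-∙ φ′ ψ′ (x ++ (c ++ d))))
    where
    φ′ ψ′ : Formula L (n + (p + q))
    φ′ = rename (reindex n (_↑ˡ q)) φ
    ψ′ = rename (reindex n (p ↑ʳ_)) ψ
    lookup-c : lookup c ≗ lookup (c ++ d) ∘ (_↑ˡ q)
    lookup-c i = sym (lookup-++ˡ c d i)
    lookup-d : lookup d ≗ lookup (c ++ d) ∘ (p ↑ʳ_)
    lookup-d j = sym (lookup-++ʳ c d j)

  definable-× : ∀ {n} {A B : Subset n} → Definable A → Definable B → Definable (λ v → A v × B v)
  definable-× = definable-connective and _×_ _×-⇔_ (λ _ _ _ → ⇔-id _)

  definable-⇔ : ExcludedMiddle 0ℓ → ∀ {n} {A B : Subset n} → Definable A → Definable B → Definable (λ v → A v ⇔ B v)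
  definable-⇔ em = definable-connective _⟺_ _⇔_ ⇔-cong-⇔ λ φ ψ v → ⇔-trans (¬⊎⇔→ em ×-⇔ ¬⊎⇔→ em) →×←⇔⇔
    where
    →×←⇔⇔ : {P Q : Set} → ((P → Q) × (Q → P)) ⇔ (P ⇔ Q)
    →×←⇔⇔ = mk⇔ (λ (f , g) → mk⇔ f g) (λ e → to e , from e)

  definable-∀ : ∀ {n} {A : Subset (suc n)} → Definable A → Definable (λ v → ∀ a → A (a ∷ v))
  definable-∀ (p , φ , c , hA) = p , all φ , c , λ x → ∀-cong-⇔ λ a → hA (a ∷ x)

  definable-∀ⁿ : ∀ q {n} {A : Subset (q + n)} → Definable A → Definable (λ v → ∀ (y : Vec M q) → A (y ++ v))
  definable-∀ⁿ zero    d = definable-cong (λ v → mk⇔ (λ a → λ { [] → a }) (λ h → h [])) d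
  definable-∀ⁿ (suc q) d = definable-cong (λ v → mk⇔ (λ h → λ { (a ∷ y) → h y a }) (λ h y a → h (a ∷ y)))
    (definable-∀ⁿ q (definable-∀ d))

  definable-∀-curried : ∀ q {n} {A : Vec M q → Vec M n → Set} →
    Definable (λ w → A (take q w) (drop q w)) → Definable (λ v → ∀ y → A y v)
  definable-∀-curried q {A = A} d =
    definable-cong (λ v → ∀-cong-⇔ λ y → ≡⇒⇔ (cong₂ A (take-++ y v) (drop-++ y v))) (definable-∀ⁿ q d)

  record IsCoordinateMap {m n} (f : Vec M m → Vec M n) : Set where
    constructor coordinateMap
    field
      arity        : ℕ
      params       : Vec M arity
      index        : Fin n → Fin (m + arity)
      lookup-index : ∀ v → lookup (f v) ≗ lookup (v ++ params) ∘ index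

  coordinateMap-renaming : ∀ {m n} {f : Vec M m → Vec M n} (ρ : Fin n → Fin m) →
    (∀ v → lookup (f v) ≗ lookup v ∘ ρ) → IsCoordinateMap f
  coordinateMap-renaming ρ h = coordinateMap 0 [] ((_↑ˡ 0) ∘ ρ) λ v i → trans (h v i) (sym (lookup-++ˡ v [] (ρ i)))

  coordinateMap-id : ∀ {m} → IsCoordinateMap {m} (λ v → v)
  coordinateMap-id = coordinateMap-renaming (λ i → i) (λ _ _ → refl)

  coordinateMap-take : ∀ k {n} → IsCoordinateMap {k + n} (take k)
  coordinateMap-take k = coordinateMap-renaming (_↑ˡ _) (lookup-take k)

  coordinateMap-drop : ∀ k {n} → IsCoordinateMap {k + n} (drop k)
  coordinateMap-drop k = coordinateMap-renaming (k ↑ʳ_) (lookup-drop k)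

  coordinateMap-const : ∀ {m n} (c : Vec M n) → IsCoordinateMap {m} (λ _ → c)
  coordinateMap-const {m} {n} c = coordinateMap n c (m ↑ʳ_) λ v i → sym (lookup-++ʳ v c i)

  coordinateMap-++ : ∀ {m n₁ n₂} {f : Vec M m → Vec M n₁} {g : Vec M m → Vec M n₂} →
    IsCoordinateMap f → IsCoordinateMap g → IsCoordinateMap (λ v → f v ++ g v)
  coordinateMap-++ {m} {n₁} {f = f} {g} (coordinateMap r₁ c₁ ρ₁ h₁) (coordinateMap r₂ c₂ ρ₂ h₂) =
    coordinateMap (r₁ + r₂) (c₁ ++ c₂) ([ reindex m (_↑ˡ r₂) ∘ ρ₁ , reindex m (r₁ ↑ʳ_) ∘ ρ₂ ]′ ∘ splitAt n₁) λ v →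
      lookup-++-via (f v) (g v) (v ++ (c₁ ++ c₂))
        (λ i → trans (h₁ v i) (lookup-reindex v _ (λ j → sym (lookup-++ˡ c₁ c₂ j)) (ρ₁ i)))
        (λ i → trans (h₂ v i) (lookup-reindex v _ (λ j → sym (lookup-++ʳ c₁ c₂ j)) (ρ₂ i)))

  coordinateMap-∘ : ∀ {m n o} {g : Vec M n → Vec M o} {f : Vec M m → Vec M n} →
    IsCoordinateMap g → IsCoordinateMap f → IsCoordinateMap (g ∘ f)
  coordinateMap-∘ {m} {n} {f = f} (coordinateMap r₂ c₂ ρ₂ h₂) (coordinateMap r₁ c₁ ρ₁ h₁) =
    coordinateMap (r₁ + r₂) (c₁ ++ c₂) ([ reindex m (_↑ˡ r₂) ∘ ρ₁ , (λ j → m ↑ʳ (r₁ ↑ʳ j)) ]′ ∘ splitAt n ∘ ρ₂) λ v i →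
      trans (h₂ (f v) i) (lookup-++-via (f v) c₂ (v ++ (c₁ ++ c₂))
        (λ j → trans (h₁ v j) (lookup-reindex v _ (λ k → sym (lookup-++ˡ c₁ c₂ k)) (ρ₁ j)))
        (λ j → sym (trans (lookup-++ʳ v (c₁ ++ c₂) (r₁ ↑ʳ j)) (lookup-++ʳ c₁ c₂ j))) (ρ₂ i))

  definable-sat : ∀ {m n} {h : Vec M m → Vec M n} (φ : Formula L n) → IsCoordinateMap h → Definable (Sat φ ∘ h)
  definable-sat φ (coordinateMap r c ρ hρ) = r , rename ρ φ , c , λ v → ⇔-sym (sat-rename ρ (hρ v) φ)

  definable-preimage : ∀ {m n} {A : Subset n} {f : Vec M m → Vec M n} →
    IsCoordinateMap f → Definable A → Definable (A ∘ f)
  definable-preimage {f = f} hf (p , φ , d , hA) = definable-cong (λ v → ⇔-sym (hA (f v)))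
    (definable-sat φ (coordinateMap-∘ (coordinateMap-++ coordinateMap-id (coordinateMap-const d)) hf))

  definable-Pow : ∀ {a} {X : Subset a} → Definable X → ∀ k → Definable (Pow X k)
  definable-Pow dX zero    = definable-⊤
  definable-Pow dX (suc k) =
    definable-× (definable-preimage (coordinateMap-take _) dX) (definable-preimage (coordinateMap-drop _) (definable-Pow dX k))

  Pow-splitPow : ∀ {a} (X : Subset a) k {k′} (v : Vec M ((k + k′) * a)) →
    Pow X k (proj₁ (splitPow a k {k′} v)) → Pow X k′ (proj₂ (splitPow a k {k′} v)) → Pow X (k + k′) v
  Pow-splitPow X zero         v _       p′ = p′
  Pow-splitPow {a} X (suc k) {k′} v (x , p) p′ =
    to (≡⇒⇔ (cong X (take-++ (take a v) _))) x ,
    Pow-splitPow X k {k′} (drop a v) (to (≡⇒⇔ (cong (Pow X k) (drop-++ (take a v) _))) p) p′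

  coordinateMap-splitPow₁ : ∀ a k {k′} → IsCoordinateMap (λ v → proj₁ (splitPow a k {k′} v))
  coordinateMap-splitPow₁ a zero         = coordinateMap-const []
  coordinateMap-splitPow₁ a (suc k) {k′} =
    coordinateMap-++ (coordinateMap-take a) (coordinateMap-∘ (coordinateMap-splitPow₁ a k {k′}) (coordinateMap-drop a))

  coordinateMap-splitPow₂ : ∀ a k {k′} → IsCoordinateMap (λ v → proj₂ (splitPow a k {k′} v))
  coordinateMap-splitPow₂ a zero         = coordinateMap-id
  coordinateMap-splitPow₂ a (suc k) {k′} = coordinateMap-∘ (coordinateMap-splitPow₂ a k {k′}) (coordinateMap-drop a)

-- Orthogonality

module Orthogonality (em : ExcludedMiddle 0ℓ) {L : Language} (𝓜 : Structure L) where
  open Semantics 𝓜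
  open Definability 𝓜

  curryᵛ : ∀ {p q} → Subset (p + q) → Vec M p → Vec M q → Set
  curryᵛ D x y = D (x ++ y)

  Prod-++ : ∀ {p q} (U : Subset p) (V : Subset q) (x : Vec M p) (y : Vec M q) → Prod U V (x ++ y) ⇔ (U x × V y)
  Prod-++ U V x y = ≡⇒⇔ (cong₂ _×_ (cong U (take-++ x y)) (cong V (drop-++ x y)))

  finUnionOfBoxes⇒boxCover : ∀ {p q} {P : Subset p} {Q : Subset q} {D : Subset (p + q)} →
    FinUnionOfBoxes P Q D → Σ (List Box) (BoxCover (curryᵛ D))
  finUnionOfBoxes⇒boxCover (bs , _ , D⇔) = bs , λ x y → ⇔-trans (D⇔ (x ++ y))
    (mk⇔ (Any.map λ { {U , V} → to (Prod-++ U V x y) }) (Any.map λ { {U , V} → from (Prod-++ U V x y) }))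

  finiteFibreTypes⇒finUnionOfBoxes : ∀ {p q} {P : Subset p} {Q : Subset q} {D : Subset (p + q)} →
    Definable P → Definable Q → Definable D → D ⊆ Prod P Q → FiniteFibreTypes P (curryᵛ D) → FinUnionOfBoxes P Q D
  finiteFibreTypes⇒finUnionOfBoxes {p} {q} {P} {Q} {D} dP dQ dD D⊆ (xs , types) =
    List.map box xs , All.map⁺ (All.universal isBox xs) , λ v → mk⇔ (cover v) (covered v)
    where
    box : Vec M p → Subset p × Subset q
    box x′ = (λ x → P x × SameFibre (curryᵛ D) x x′) , (λ y → Q y × D (x′ ++ y))

    isBox : ∀ x′ → IsBoxFor P Q (box x′)
    isBox x′ =
      (definable-× dP (definable-∀-curried q (definable-⇔ em
         (definable-preimage (coordinateMap-++ (coordinateMap-drop q) (coordinateMap-take q)) dD)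
         (definable-preimage (coordinateMap-++ (coordinateMap-const x′) (coordinateMap-take q)) dD))) , λ _ → proj₁) ,
      (definable-× dQ (definable-preimage (coordinateMap-++ (coordinateMap-const x′) coordinateMap-id) dD) , λ _ → proj₁)

    D-split : ∀ v → D v ⇔ D (take p v ++ drop p v)
    D-split v = ≡⇒⇔ (cong D (sym (take++drop≡id p v)))

    cover : ∀ v → D v → Any (λ { (U , V) → Prod U V v }) (List.map box xs)
    cover v d = Any.map⁺ (Any.map (λ same → (px , same) , qy , to (same (drop p v)) (to (D-split v) d))
                                  (types (take p v) px))
      where
      px = proj₁ (D⊆ v d)
      qy = proj₂ (D⊆ v d)

    covered : ∀ v → Any (λ { (U , V) → Prod U V v }) (List.map box xs) → D v
    covered v inBox with Any.satisfied (Any.map⁻ inBox)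
    ... | _ , (_ , same) , _ , d = from (D-split v) (from (same (drop p v)) d)

  module _ {a b : ℕ} {X : Subset a} {Y : Subset b} (dX : Definable X) (dY : Definable Y) where

    BoxDecomposable : ℕ → Set₁
    BoxDecomposable l = ∀ k (D : Subset (k * a + l * b)) → Definable D →
      D ⊆ Prod (Pow X k) (Pow Y l) → FinUnionOfBoxes (Pow X k) (Pow Y l) D

    BoxDecomposableInY : Set₁
    BoxDecomposableInY = (n : ℕ) → 1 ≤ n → (D : Subset (n * a + b)) → Definable D →
      D ⊆ Prod (Pow X n) Y → FinUnionOfBoxes (Pow X n) Y D

    FiniteFibreTypesInY : Set₁
    FiniteFibreTypesInY = ∀ k (D : Subset (k * a + b)) → Definable D →
      D ⊆ Prod (Pow X k) Y → FiniteFibreTypes (Pow X k) (curryᵛ D)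

    boxDecomposable-zero : BoxDecomposable 0
    boxDecomposable-zero k D dD D⊆ =
      finiteFibreTypes⇒finUnionOfBoxes (definable-Pow dX k) definable-⊤ dD D⊆ (finiteFibreTypes-Vec₀ʳ em _ _)

    boxDecomposable-suc : FiniteFibreTypesInY → ∀ {l} → BoxDecomposable l → BoxDecomposable (suc l)
    boxDecomposable-suc inY {l} ih k D dD D⊆ =
      finiteFibreTypes⇒finUnionOfBoxes (definable-Pow dX k) (definable-Pow dY (suc l)) dD D⊆
        (finiteFibreTypes-map (λ w → take b w , drop b w) D-split
          (finiteFibreTypes-glue em P Qˡ S S⊆Qˡ sections sameFibreAt-types))
      where
      p = k * a
      m = (k + k) * a
      P = Pow X k
      Qˡ = Pow Y l

      S : Vec M p → Vec M b → Vec M (l * b) → Set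
      S x y z = D (x ++ (y ++ z))

      D-split : ∀ x w → D (x ++ w) ⇔ S x (take b w) (drop b w)
      D-split x w = ≡⇒⇔ (cong (λ u → D (x ++ u)) (sym (take++drop≡id b w)))

      S⊆ : ∀ x y z → S x y z → P x × Y y × Qˡ z
      S⊆ x y z s with D⊆ _ s
      ... | px , py , pz rewrite take-++ x (y ++ z) | drop-++ x (y ++ z) | take-++ y z | drop-++ y z = px , py , pz

      S⊆Qˡ : ∀ x y z → S x y z → Qˡ z
      S⊆Qˡ x y z s = proj₂ (proj₂ (S⊆ x y z s))

      sections : ∀ z → FiniteFibreTypes P (Section P Qˡ S z)
      sections z = finiteFibreTypes-map (λ y → y)
        (λ x y → ≡⇒⇔ (cong₂ (λ x′ y′ → S x′ y′ z) (sym (take-++ x y)) (sym (drop-++ x y))))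
        (inY k (λ u → S (take p u) (drop p u) z)
          (definable-preimage (coordinateMap-++ (coordinateMap-take p)
            (coordinateMap-++ (coordinateMap-drop p) (coordinateMap-const z))) dD)
          (λ u s → let px , py , _ = S⊆ _ _ z s in px , py))

      E : Subset (m + l * b)
      E v = SameFibreAt P Qˡ S (drop m v) (splitPow a k {k} (take m v))

      dE : Definable E
      dE = definable-× (definable-preimage firstHalf dP) (definable-× (definable-preimage secondHalf dP)
        (definable-× (definable-preimage (coordinateMap-drop m) (definable-Pow dY l))
          (definable-∀-curried b (definable-⇔ em (definable-preimage (insertY firstHalf) dD)
                                                 (definable-preimage (insertY secondHalf) dD)))))
        where
        dP = definable-Pow dX k
        firstHalf = coordinateMap-∘ (coordinateMap-splitPow₁ a k {k}) (coordinateMap-take m)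
        secondHalf = coordinateMap-∘ (coordinateMap-splitPow₂ a k {k}) (coordinateMap-take m)
        insertY : ∀ {f : Vec M (m + l * b) → Vec M p} → IsCoordinateMap f →
          IsCoordinateMap (λ w → f (drop b w) ++ (take b w ++ drop m (drop b w)))
        insertY cf = coordinateMap-++ (coordinateMap-∘ cf (coordinateMap-drop b))
          (coordinateMap-++ (coordinateMap-take b) (coordinateMap-∘ (coordinateMap-drop m) (coordinateMap-drop b)))

      E⊆ : E ⊆ Prod (Pow X (k + k)) Qˡ
      E⊆ v (px₁ , px₂ , qz , _) = Pow-splitPow X k {k} (take m v) px₁ px₂ , qz

      E-appendPow : ∀ z xx → SameFibreAt P Qˡ S z xx ⇔ E (appendPow a k {k} (proj₁ xx) (proj₂ xx) ++ z)
      E-appendPow z (x , x′) = ≡⇒⇔ (cong₂ (SameFibreAt P Qˡ S) (sym (drop-++ xx′ z))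
        (sym (trans (cong (splitPow a k {k}) (take-++ xx′ z)) (splitPow-appendPow a k {k} x x′))))
        where xx′ = appendPow a k {k} x x′

      sameFibreAt-types : FiniteFibreTypes Qˡ (SameFibreAt P Qˡ S)
      sameFibreAt-types = finiteFibreTypes-map (λ (x , x′) → appendPow a k {k} x x′) E-appendPow
        (boxCover⇒finiteFibreTypesʳ em (proj₂ (finUnionOfBoxes⇒boxCover (ih (k + k) E dE E⊆))) Qˡ)

    boxDecomposable : FiniteFibreTypesInY → ∀ l → BoxDecomposable l
    boxDecomposable inY zero    = boxDecomposable-zero
    boxDecomposable inY (suc l) = boxDecomposable-suc inY (boxDecomposable inY l)

    boxDecomposableInY⇒finiteFibreTypesInY : BoxDecomposableInY → FiniteFibreTypesInY
    boxDecomposableInY⇒finiteFibreTypesInY decomposable zero    D _  _  = finiteFibreTypes-Vec₀ˡ _ _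
    boxDecomposableInY⇒finiteFibreTypesInY decomposable (suc k) D dD D⊆ =
      boxCover⇒finiteFibreTypesˡ em (proj₂ (finUnionOfBoxes⇒boxCover (decomposable (suc k) (s≤s z≤n) D dD D⊆))) _

    -- Pow Y 1 lives in M^(b + 0) rather than M^b, so D is first transported to D₁ ⊆ Xⁿ × Y¹.
    orthogonal⇒boxDecomposableInY : Orthogonal X Y → BoxDecomposableInY
    orthogonal⇒boxDecomposableInY orthogonal n _ D dD D⊆ =
      finiteFibreTypes⇒finUnionOfBoxes (definable-Pow dX n) dY dD D⊆
        (finiteFibreTypes-map (_++ []) D-pad
          (boxCover⇒finiteFibreTypesˡ em (proj₂ (finUnionOfBoxes⇒boxCover (orthogonal n 1 D₁ dD₁ D₁⊆))) _))
      where
      p = n * a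

      D₁ : Subset (p + 1 * b)
      D₁ v = D (take p v ++ take b (drop p v))

      dD₁ : Definable D₁
      dD₁ = definable-preimage
        (coordinateMap-++ (coordinateMap-take p) (coordinateMap-∘ (coordinateMap-take b) (coordinateMap-drop p))) dD

      D₁⊆ : D₁ ⊆ Prod (Pow X n) (Pow Y 1)
      D₁⊆ v d with D⊆ _ d
      ... | px , py rewrite take-++ (take p v) (take b (drop p v)) | drop-++ (take p v) (take b (drop p v)) = px , py , tt

      D-pad : ∀ x y → D (x ++ y) ⇔ D₁ (x ++ (y ++ []))
      D-pad x y = ≡⇒⇔ (cong D (sym (cong₂ _++_ (take-++ x (y ++ []))
                                            (trans (cong (take b) (drop-++ x (y ++ []))) (take-++ y [])))))

corollary2p8 : ExcludedMiddle 0ℓ →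
    {L : Language} (𝓜 : Structure L) → let open Semantics 𝓜 in
    {a b : ℕ} (X : Subset a) (Y : Subset b) → Definable X → Definable Y →
    Orthogonal X Y ⇔
    ((n : ℕ) → 1 ≤ n → (D : Subset (n * a + b)) → Definable D →
    D ⊆ Prod (Pow X n) Y → FinUnionOfBoxes (Pow X n) Y D)
corollary2p8 em 𝓜 X Y dX dY = mk⇔ (orthogonal⇒boxDecomposableInY dX dY) λ decomposable k l →
  boxDecomposable dX dY (boxDecomposableInY⇒finiteFibreTypesInY dX dY decomposable) l k
  where open Orthogonality em 𝓜
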